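{- Let $G$ be a finite connected simple graph with $n\geq 3$ vertices. (1) If $G=C_5$, then $\gamma_8^s(G)=15$ and $\gamma_k^s(G)=2k$ for $k\in\{2,4,6\}$. (2) If $G$ is a $\{P_5\}$-branch graph, then $\gamma_8^s(G)=3n$ and $\gamma_k^s(G)=2kn/5$ for $k\in\{2,4,6\}$. (3) If $G$ is a $\{P_4\}$-branch graph, then $\gamma_k^s(G)=3kn/8$ for every even integer $k\geq 8$. (4) If $G$ is a $\{P_4\}$-branch graph, then $\gamma_k^s(G)=(3k+1)n/8$ for every odd integer $k\geq 3$. (5) If $G$ is a $\{P_4,P_5\}$-branch graph, then $\gamma_8^s(G)=3n$.
   Context: For a positive integer $k$ and $f:V(G)\to\{0,1,\dots,k\}$ let $w(f)=\sum_v f(v)$. $f$ is a strong Roman $k$-dominating function ($k$-SRDF) if every $u$ with $f(u)<k/2$ satisfies $f(u)+\sum_{v\in N_G(u),\, f(v)>k/2}f(v)\geq k$, where $N_G(u)$ is the open neighbourhood; $\gamma_k^s(G)$ is the minimum weight of a $k$-SRDF. $P_r$, $C_r$ denote the path and cycle on $r$ vertices. A center of a graph is a vertex minimizing the maximum distance to other vertices. Given a graph $H$ and rooted graphs $\{K_x: x\in V(H)\}$, the rooted product $H(\mathcal{K})$ is the union of $H$ and the disjoint graphs $K_x$, identifying each $x\in V(H)$ with the root of $K_x$. For a set $\mathcal{B}$ of graphs, a $\mathcal{B}$-branch graph is a graph $H(\mathcal{K})$ with $H$ connected and each $K_x$ a graph in $\mathcal{B}$ rooted at one of its centers ($P_5$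 at its middle vertex, $P_4$ at one of its two inner vertices). -}

module Defs where

open import Data.Nat using (ℕ; zero; suc; _+_; _*_; _≤_; _<_; _≡ᵇ_; _<ᵇ_)
open import Data.Bool using (Bool; true; false; _∧_; _∨_; if_then_else_)
open import Data.Bool.Properties using (∨-comm; ∧-comm)
open import Data.Fin using (Fin; toℕ; _≟_)
open import Data.List using (List; map; allFin)
open import Data.Nat.ListAction using (sum)
open import Data.Product using (Σ; _×_; _,_; ∃)
open import Data.Sum using (_⊎_)
open import Relation.Nullary using (yes; no; ¬_)
open import Relation.Nullary.Decidable using (⌊_⌋)
open import Relation.Binary.PropositionalEquality using (_≡_; refl; sym; trans; cong₂)
open import Function.Bundles using (_↔_; Inverse)

record Graph (V : Set) : Set where
  field
    adj    : V → V → Bool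
    adjSym : ∀ u v → adj u v ≡ adj v u
    adjIrr : ∀ u → adj u u ≡ false
open Graph public

data Reach {V : Set} (G : Graph V) (u : V) : V → Set where
  here : Reach G u u
  step : ∀ {v w} → Reach G u v → adj G v w ≡ true → Reach G u w

Connected : {V : Set} → Graph V → Set
Connected G = ∀ u v → Reach G u v

Iso : {V W : Set} → Graph V → Graph W → Set
Iso {V} {W} G H = Σ (V ↔ W) λ σ →
  ∀ u v → adj G u v ≡ adj H (Inverse.to σ u) (Inverse.to σ v)

private
  suc≢ᵇ : ∀ t → (suc t ≡ᵇ t) ≡ false
  suc≢ᵇ zero = refl
  suc≢ᵇ (suc t) = suc≢ᵇ t

  ≡ᵇ-sym : ∀ a b → (a ≡ᵇ b) ≡ (b ≡ᵇ a)
  ≡ᵇ-sym zero zero = refl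
  ≡ᵇ-sym zero (suc b) = refl
  ≡ᵇ-sym (suc a) zero = refl
  ≡ᵇ-sym (suc a) (suc b) = ≡ᵇ-sym a b

pathAdj : (r : ℕ) → Fin r → Fin r → Bool
pathAdj r i j = (suc (toℕ i) ≡ᵇ toℕ j) ∨ (suc (toℕ j) ≡ᵇ toℕ i)

P : (r : ℕ) → Graph (Fin r)
P r = record
  { adj = pathAdj r
  ; adjSym = λ i j → ∨-comm (suc (toℕ i) ≡ᵇ toℕ j) (suc (toℕ j) ≡ᵇ toℕ i)
  ; adjIrr = λ i → irr i }
  where
  irr : ∀ i → pathAdj r i i ≡ false
  irr i rewrite suc≢ᵇ (toℕ i) = refl

c5Adj : Fin 5 → Fin 5 → Bool
c5Adj i j = pathAdj 5 i j ∨ ((toℕ i ≡ᵇ 0) ∧ (toℕ j ≡ᵇ 4)) ∨ ((toℕ i ≡ᵇ 4) ∧ (toℕ j ≡ᵇ 0))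

private
  c5Sym : ∀ i j → c5Adj i j ≡ c5Adj j i
  c5Sym i j = cong₂ _∨_
    (∨-comm (suc (toℕ i) ≡ᵇ toℕ j) (suc (toℕ j) ≡ᵇ toℕ i))
    (trans (cong₂ _∨_ (∧-comm (toℕ i ≡ᵇ 0) (toℕ j ≡ᵇ 4)) (∧-comm (toℕ i ≡ᵇ 4) (toℕ j ≡ᵇ 0)))
           (∨-comm ((toℕ j ≡ᵇ 4) ∧ (toℕ i ≡ᵇ 0)) ((toℕ j ≡ᵇ 0) ∧ (toℕ i ≡ᵇ 4))))

  c5Irr : ∀ i → c5Adj i i ≡ false
  c5Irr Fin.zero = refl
  c5Irr (Fin.suc Fin.zero) = refl
  c5Irr (Fin.suc (Fin.suc Fin.zero)) = refl
  c5Irr (Fin.suc (Fin.suc (Fin.suc Fin.zero))) = refl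
  c5Irr (Fin.suc (Fin.suc (Fin.suc (Fin.suc Fin.zero)))) = refl

C5 : Graph (Fin 5)
C5 = record { adj = c5Adj ; adjSym = c5Sym ; adjIrr = c5Irr }

-- Rooted product H(K): vertex (x , i) is vertex i of K_x; (x , root x) is x.
module _ {m : ℕ} (H : Graph (Fin m)) {s : Fin m → ℕ}
         (K : (x : Fin m) → Graph (Fin (s x))) (root : (x : Fin m) → Fin (s x)) where

  rpAdj : Σ (Fin m) (λ x → Fin (s x)) → Σ (Fin m) (λ x → Fin (s x)) → Bool
  rpAdj (x , i) (y , j) with x ≟ y
  ... | yes refl = adj (K x) i j
  ... | no _ = adj H x y ∧ ⌊ i ≟ root x ⌋ ∧ ⌊ j ≟ root y ⌋

  private
    rpSym : ∀ a b → rpAdj a b ≡ rpAdj b a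
    rpSym (x , i) (y , j) with x ≟ y | y ≟ x
    ... | yes refl | yes refl = adjSym (K x) i j
    ... | yes refl | no ¬p = Data.Empty.⊥-elim (¬p refl)
      where import Data.Empty
    ... | no ¬p | yes refl = Data.Empty.⊥-elim (¬p refl)
      where import Data.Empty
    ... | no _ | no _ rewrite adjSym H x y
                             | ∧-comm ⌊ i ≟ root x ⌋ ⌊ j ≟ root y ⌋ = refl

    rpIrr : ∀ a → rpAdj a a ≡ false
    rpIrr (x , i) with x ≟ x
    ... | yes refl = adjIrr (K x) i
    ... | no ¬p = Data.Empty.⊥-elim (¬p refl)
      where import Data.Empty

  RootedProduct : Graph (Σ (Fin m) (λ x → Fin (s x)))
  RootedProduct = record { adj = rpAdj ; adjSym = rpSym ; adjIrr = rpIrr }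

-- A B-branch graph, where B is given by a predicate `Allowed r c` saying
-- "P_r rooted at vertex c is a member of B rooted at one of its centers".
IsBranchGraph : (Allowed : (r : ℕ) → Fin r → Set) → {n : ℕ} → Graph (Fin n) → Set
IsBranchGraph Allowed G =
  Σ ℕ λ m → Σ (Graph (Fin m)) λ H → Connected H ×
  Σ (Fin m → ℕ) λ s → Σ ((x : Fin m) → Fin (s x)) λ root →
    (∀ x → Allowed (s x) (root x)) × Iso G (RootedProduct H (λ x → P (s x)) root)

P5Root : (r : ℕ) → Fin r → Set
P5Root r c = (r ≡ 5) × (toℕ c ≡ 2)

P4Root : (r : ℕ) → Fin r → Set
P4Root r c = (r ≡ 4) × ((toℕ c ≡ 1) ⊎ (toℕ c ≡ 2))

P4P5Root : (r : ℕ) → Fin r → Set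
P4P5Root r c = P4Root r c ⊎ P5Root r c

weight : {n : ℕ} → (Fin n → ℕ) → ℕ
weight {n} f = sum (map f (allFin n))

strongNbrSum : {n : ℕ} → Graph (Fin n) → ℕ → (Fin n → ℕ) → Fin n → ℕ
strongNbrSum {n} G k f u =
  sum (map (λ v → if adj G u v ∧ (k <ᵇ 2 * f v) then f v else 0) (allFin n))

IsSRDF : {n : ℕ} → Graph (Fin n) → ℕ → (Fin n → ℕ) → Set
IsSRDF G k f =
  (∀ v → f v ≤ k) ×
  (∀ u → 2 * f u < k → k ≤ f u + strongNbrSum G k f u)

StrongRomanNumber : {n : ℕ} → Graph (Fin n) → ℕ → ℕ → Set
StrongRomanNumber G k w =
  (∃ λ f → IsSRDF G k f × weight f ≡ w) ×
  (∀ f → IsSRDF G k f → w ≤ weight f)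

-- A vertex of a branch other than its root is adjacent only to vertices of its own branch.  So an
-- SRDF of a branch graph restricts on every branch to a function satisfying the strong Roman
-- condition except possibly at the root, and conversely SRDFs of the branches glue to an SRDF of
-- the whole graph: γ is the sum over the branches of a local value β.  For P₄ rooted at an inner
-- vertex b, β = k + ⌈k/2⌉: if b is strong then b and its leaf carry k and the far pair k/2,
-- otherwise the far pair carries k and the near pair k/2.  For P₅, and for C₅ itself, the value is
-- found by exhaustive search over all functions into {0, …, k}.
{-# OPTIONS --safe #-}
module Submission where

open import Defs
open import Data.Nat.Properties hiding (_≟_)
open import Algebra.Properties.Semiring.Sum +-*-semiring
  using (sum; sum-syntax; sum-cong-≗; sum-remove; sum-replicate-zero; ∑-comm; ∑-permute; *-distribˡ-sum)
open import Axiom.UniquenessOfIdentityProofs using (module Decidable⇒UIP)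
open import Data.Bool using (Bool; true; false; T; if_then_else_; _∧_)
open import Data.Bool.Properties using (∧-zeroʳ; T-∧; T-≡)
open import Data.Empty using (⊥-elim)
open import Data.Fin using (Fin; zero; suc; toℕ; punchIn; _≟_)
open import Data.Fin.Patterns using (0F; 1F; 2F; 3F)
open import Data.Fin.Properties using (punchInᵢ≢i; all?)
import Data.List as List
open import Data.Nat using (ℕ; zero; suc; _+_; _*_; _≤_; _<_; _<ᵇ_; _≤?_; _<?_; z≤n; s≤s; z<s; NonZero)
open import Data.Nat.DivMod using (_/_; m*n/n≡m; n/1≡n)
open import Data.Nat.ListAction using () renaming (sum to sumˡ)
open import Data.Nat.Tactic.RingSolver using (solve-∀)
open import Data.Product using (Σ; _×_; _,_; proj₁; proj₂; ∃)
open import Data.Product.Properties using (,-injectiveʳ-UIP)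
open import Data.Sum using (_⊎_; inj₁; inj₂; [_,_])
import Data.Sum as Sum
open import Data.Unit using (tt)
open import Data.Vec.Functional using ([]; _∷_)
open import Function using (_∘_; id; _↔_; Inverse; Equivalence)
open import Function.Properties.Inverse using (↔-sym)
open import Relation.Nullary using (Dec; does; yes; no; ¬?)
open import Relation.Nullary.Decidable
  using (dec-true; dec-false; True; ⌊_⌋; toWitness; fromWitness; _×-dec_; _⊎-dec_; _→-dec_)
open import Relation.Binary.PropositionalEquality
  using (_≡_; _≢_; _≗_; refl; sym; trans; cong; cong₂; subst; module ≡-Reasoning)

private
  variable
    k m n : ℕ

sum-map-tabulate : ∀ {A : Set} (f : A → ℕ) (g : Fin n → A) →
  sumˡ (List.map f (List.tabulate g)) ≡ ∑[ i < n ] f (g i)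
sum-map-tabulate {zero}  f g = refl
sum-map-tabulate {suc n} f g = cong (f (g zero) +_) (sum-map-tabulate f (g ∘ suc))

∑-mono-≤ : {f g : Fin n → ℕ} → (∀ i → f i ≤ g i) → ∑[ i < n ] f i ≤ ∑[ i < n ] g i
∑-mono-≤ {zero}  f≤g = z≤n
∑-mono-≤ {suc n} f≤g = +-mono-≤ (f≤g zero) (∑-mono-≤ (f≤g ∘ suc))

≤-∑ : (f : Fin n → ℕ) (i : Fin n) → f i ≤ ∑[ j < n ] f j
≤-∑ {suc n} f i = ≤-trans (m≤m+n (f i) _) (≤-reflexive (sym (sum-remove {i = i} f)))

∑-zero : {f : Fin n → ℕ} → (∀ i → f i ≡ 0) → ∑[ i < n ] f i ≡ 0
∑-zero {n} f≡0 = trans (sum-cong-≗ f≡0) (sum-replicate-zero n)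

∑-single : {f : Fin n → ℕ} (i : Fin n) → (∀ j → j ≢ i → f j ≡ 0) → ∑[ j < n ] f j ≡ f i
∑-single {suc n} {f} i f≡0 = begin
  ∑[ j < suc n ] f j                ≡⟨ sum-remove {i = i} f ⟩
  f i + ∑[ j < n ] f (punchIn i j)  ≡⟨ cong (f i +_) (∑-zero (λ j → f≡0 _ (punchInᵢ≢i i j))) ⟩
  f i + 0                           ≡⟨ +-identityʳ (f i) ⟩
  f i                               ∎
  where open ≡-Reasoning

∑-const : ∀ n c → ∑[ i < n ] c ≡ n * c
∑-const zero    c = refl
∑-const (suc n) c = cong (c +_) (∑-const n c)

module _ (s : Fin m → ℕ) where

  ∑Σ : (Σ (Fin m) (Fin ∘ s) → ℕ) → ℕ
  ∑Σ h = ∑[ x < m ] ∑[ i < s x ] h (x , i)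

  ∑Σ-single : {h : Σ (Fin m) (Fin ∘ s) → ℕ} (w : Σ (Fin m) (Fin ∘ s)) →
    (∀ w′ → w′ ≢ w → h w′ ≡ 0) → ∑Σ h ≡ h w
  ∑Σ-single {h} (x , i) h≡0 = begin
    ∑Σ h                    ≡⟨ ∑-single x (λ y y≢x → ∑-zero (λ j → h≡0 (y , j) (y≢x ∘ cong proj₁))) ⟩
    ∑[ j < s x ] h (x , j)  ≡⟨ ∑-single i (λ j j≢i → h≡0 (x , j) (j≢i ∘ ,-injectiveʳ-UIP Fin-UIP)) ⟩
    h (x , i)               ∎
    where
    open ≡-Reasoning
    open Decidable⇒UIP (_≟_ {m}) using () renaming (≡-irrelevant to Fin-UIP)

  ∑-∑Σ-comm : (F : Fin n → Σ (Fin m) (Fin ∘ s) → ℕ) →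
    ∑[ v < n ] ∑Σ (F v) ≡ ∑Σ (λ w → ∑[ v < n ] F v w)
  ∑-∑Σ-comm F = trans (∑-comm (λ v x → ∑[ i < s x ] F v (x , i)))
                      (sum-cong-≗ (λ x → ∑-comm (λ v i → F v (x , i))))

  -- Both sides equal the double sum over v and w of h w if from w ≡ v, and 0 otherwise.
  ∑-reindexΣ : (σ : Fin n ↔ Σ (Fin m) (Fin ∘ s)) (h : Σ (Fin m) (Fin ∘ s) → ℕ) →
    ∑[ v < n ] h (Inverse.to σ v) ≡ ∑Σ h
  ∑-reindexΣ {n} σ h = begin
    ∑[ v < n ] h (to v)          ≡⟨ sum-cong-≗ (λ v → sym (∑Σ-δ v)) ⟩
    ∑[ v < n ] ∑Σ (δ v)          ≡⟨ ∑-∑Σ-comm δ ⟩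
    ∑Σ (λ w → ∑[ v < n ] δ v w)  ≡⟨ sum-cong-≗ (λ x → sum-cong-≗ (λ i → ∑-δ (x , i))) ⟩
    ∑Σ h                         ∎
    where
    open ≡-Reasoning
    open Inverse σ

    δ : Fin n → Σ (Fin m) (Fin ∘ s) → ℕ
    δ v w = if does (from w ≟ v) then h w else 0

    δ-on : ∀ {v w} → from w ≡ v → δ v w ≡ h w
    δ-on {v} {w} eq rewrite dec-true (from w ≟ v) eq = refl

    δ-off : ∀ {v w} → from w ≢ v → δ v w ≡ 0
    δ-off {v} {w} neq rewrite dec-false (from w ≟ v) neq = refl

    ∑Σ-δ : ∀ v → ∑Σ (δ v) ≡ h (to v)
    ∑Σ-δ v = trans
      (∑Σ-single (to v) (λ w w≢ → δ-off (λ eq → w≢ (trans (sym (strictlyInverseˡ w)) (cong to eq)))))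
      (δ-on (strictlyInverseʳ v))

    ∑-δ : ∀ w → ∑[ v < n ] δ v w ≡ h w
    ∑-δ w = trans (∑-single (from w) (λ v v≢ → δ-off (v≢ ∘ sym))) (δ-on refl)

strongContribution : ℕ → Bool → ℕ → ℕ
strongContribution k adjacent x = if adjacent ∧ (k <ᵇ 2 * x) then x else 0

strongContribution-≤ : ∀ k a x → strongContribution k a x ≤ x
strongContribution-≤ k a x with a ∧ (k <ᵇ 2 * x)
... | true  = ≤-refl
... | false = z≤n

strongContribution-strong : ∀ {k x} → k < 2 * x → strongContribution k true x ≡ x
strongContribution-strong {k} {x} k<2x with k <ᵇ 2 * x in eq
... | true  = refl
... | false = ⊥-elim (subst T eq (<⇒<ᵇ k<2x))

strongContribution-weak : ∀ {k x} → 2 * x ≤ k → strongContribution k true x ≡ 0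
strongContribution-weak {k} {x} 2x≤k with k <ᵇ 2 * x in eq
... | true  = ⊥-elim (≤⇒≯ 2x≤k (<ᵇ⇒< k (2 * x) (subst T (sym eq) tt)))
... | false = refl

Defended : Graph (Fin n) → ℕ → (Fin n → ℕ) → Fin n → Set
Defended G k f u = 2 * f u < k → k ≤ f u + strongNbrSum G k f u

IsSRDFExcept : Graph (Fin n) → ℕ → Fin n → (Fin n → ℕ) → Set
IsSRDFExcept G k c f = (∀ v → f v ≤ k) × (∀ u → u ≢ c → Defended G k f u)

weight-∑ : (f : Fin n → ℕ) → weight f ≡ ∑[ v < n ] f v
weight-∑ f = sum-map-tabulate f id

strongNbrSum-∑ : (G : Graph (Fin n)) (k : ℕ) (f : Fin n → ℕ) (u : Fin n) →
  strongNbrSum G k f u ≡ ∑[ v < n ] strongContribution k (adj G u v) (f v)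
strongNbrSum-∑ G k f u = sum-map-tabulate (λ v → strongContribution k (adj G u v) (f v)) id

weight-cong : {f g : Fin n → ℕ} → f ≗ g → weight f ≡ weight g
weight-cong {f = f} {g} f≗g = trans (weight-∑ f) (trans (sum-cong-≗ f≗g) (sym (weight-∑ g)))

strongNbrSum-cong : (G : Graph (Fin n)) (k : ℕ) {f g : Fin n → ℕ} → f ≗ g → ∀ u →
  strongNbrSum G k f u ≡ strongNbrSum G k g u
strongNbrSum-cong G k {f} {g} f≗g u = begin
  strongNbrSum G k f u                               ≡⟨ strongNbrSum-∑ G k f u ⟩
  ∑[ v < _ ] strongContribution k (adj G u v) (f v)  ≡⟨ sum-cong-≗ (cong (strongContribution k _) ∘ f≗g) ⟩
  ∑[ v < _ ] strongContribution k (adj G u v) (g v)  ≡⟨ strongNbrSum-∑ G k g u ⟨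
  strongNbrSum G k g u                               ∎
  where open ≡-Reasoning

Defended-resp-≗ : (G : Graph (Fin n)) {f g : Fin n → ℕ} → f ≗ g → ∀ u →
  Defended G k f u → Defended G k g u
Defended-resp-≗ {k = k} G f≗g u defended weak =
  subst (k ≤_) (cong₂ _+_ (f≗g u) (strongNbrSum-cong G k f≗g u))
    (defended (subst (λ t → 2 * t < k) (sym (f≗g u)) weak))

bounded-resp-≗ : {f g : Fin n → ℕ} → f ≗ g → (∀ v → f v ≤ k) → ∀ v → g v ≤ k
bounded-resp-≗ {k = k} f≗g bounded v = subst (_≤ k) (f≗g v) (bounded v)

IsSRDF-resp-≗ : (G : Graph (Fin n)) {f g : Fin n → ℕ} → f ≗ g → IsSRDF G k f → IsSRDF G k g
IsSRDF-resp-≗ G f≗g (bounded , defended) =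
  bounded-resp-≗ f≗g bounded , λ u → Defended-resp-≗ G f≗g u (defended u)

IsSRDFExcept-resp-≗ : (G : Graph (Fin n)) {c : Fin n} {f g : Fin n → ℕ} → f ≗ g →
  IsSRDFExcept G k c f → IsSRDFExcept G k c g
IsSRDFExcept-resp-≗ G f≗g (bounded , defended) =
  bounded-resp-≗ f≗g bounded , λ u u≢c → Defended-resp-≗ G f≗g u (defended u u≢c)

Iso-sym : {V W : Set} {G : Graph V} {H : Graph W} → Iso G H → Iso H G
Iso-sym {H = H} (σ , preserves) = ↔-sym σ , λ u v →
  sym (trans (preserves (from u) (from v)) (cong₂ (adj H) (strictlyInverseˡ u) (strictlyInverseˡ v)))
  where open Inverse σ

module Transport {B : Set} (G : Graph (Fin n)) (H : Graph B) (iso : Iso G H)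
  (∑ᴮ : (B → ℕ) → ℕ) (reindex : ∀ h → ∑[ v < n ] h (Inverse.to (proj₁ iso) v) ≡ ∑ᴮ h) where

  open Inverse (proj₁ iso)

  weight-∘to : (g : B → ℕ) → weight (g ∘ to) ≡ ∑ᴮ g
  weight-∘to g = trans (weight-∑ (g ∘ to)) (reindex g)

  strongNbrSum-∘to : (k : ℕ) (g : B → ℕ) (u : Fin n) →
    strongNbrSum G k (g ∘ to) u ≡ ∑ᴮ (λ w → strongContribution k (adj H (to u) w) (g w))
  strongNbrSum-∘to k g u = begin
    strongNbrSum G k (g ∘ to) u
      ≡⟨ strongNbrSum-∑ G k (g ∘ to) u ⟩
    ∑[ v < n ] strongContribution k (adj G u v) (g (to v))
      ≡⟨ sum-cong-≗ (λ v → cong (λ a → strongContribution k a (g (to v))) (proj₂ iso u v)) ⟩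
    ∑[ v < n ] strongContribution k (adj H (to u) (to v)) (g (to v))
      ≡⟨ reindex _ ⟩
    ∑ᴮ (λ w → strongContribution k (adj H (to u) w) (g w))
      ∎
    where open ≡-Reasoning

module _ (G : Graph (Fin n)) (H : Graph (Fin m)) (iso : Iso G H) where

  open Inverse (proj₁ iso)
  open Transport G H iso sum (λ h → sym (∑-permute h (proj₁ iso)))

  weight-∘iso : (g : Fin m → ℕ) → weight (g ∘ to) ≡ weight g
  weight-∘iso g = trans (weight-∘to g) (sym (weight-∑ g))

  IsSRDF-∘iso : {g : Fin m → ℕ} → IsSRDF H k g → IsSRDF G k (g ∘ to)
  IsSRDF-∘iso {k = k} {g} (bounded , defended) = bounded ∘ to , λ u weak →
    subst (λ t → k ≤ g (to u) + t) (sym (strongNbrSum-∘iso u)) (defended (to u) weak)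
    where
    strongNbrSum-∘iso : ∀ u → strongNbrSum G k (g ∘ to) u ≡ strongNbrSum H k g (to u)
    strongNbrSum-∘iso u = trans (strongNbrSum-∘to k g u) (sym (strongNbrSum-∑ H k g (to u)))

StrongRomanNumber-Iso : (G : Graph (Fin n)) (H : Graph (Fin m)) {w : ℕ} →
  Iso G H → StrongRomanNumber H k w → StrongRomanNumber G k w
StrongRomanNumber-Iso G H iso ((g , srdf , weight≡w) , minimal) =
  (g ∘ Inverse.to (proj₁ iso) , IsSRDF-∘iso G H iso srdf , trans (weight-∘iso G H iso g) weight≡w) ,
  λ f srdf-f → subst (_ ≤_) (weight-∘iso H G iso⁻¹ f) (minimal _ (IsSRDF-∘iso H G iso⁻¹ srdf-f))
  where
  iso⁻¹ : Iso H G
  iso⁻¹ = Iso-sym {G = G} {H} iso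

-- The root of a branch may be defended from outside the branch, so the lower bound only assumes
-- the strong Roman condition away from the root.
BranchNumber : Graph (Fin n) → ℕ → Fin n → ℕ → Set
BranchNumber K k c β =
  (∃ λ g → IsSRDF K k g × weight g ≡ β) × (∀ g → IsSRDFExcept K k c g → β ≤ weight g)

module RootedProductBranches {m : ℕ} (H : Graph (Fin m)) {s : Fin m → ℕ}
  (K : (x : Fin m) → Graph (Fin (s x))) (root : (x : Fin m) → Fin (s x)) where

  private
    R : Graph (Σ (Fin m) (Fin ∘ s))
    R = RootedProduct H K root

  restrict : (Σ (Fin m) (Fin ∘ s) → ℕ) → (x : Fin m) → Fin (s x) → ℕ
  restrict g x i = g (x , i)

  adj-inside : ∀ x i j → adj R (x , i) (x , j) ≡ adj (K x) i j
  adj-inside x i j with x ≟ x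
  ... | yes refl = refl
  ... | no x≢x   = ⊥-elim (x≢x refl)

  adj-outside : ∀ {x y} i j → x ≢ y → i ≢ root x → adj R (x , i) (y , j) ≡ false
  adj-outside {x} {y} i j x≢y i≢root with x ≟ y
  ... | yes x≡y = ⊥-elim (x≢y x≡y)
  ... | no _ with i ≟ root x
  ...   | yes i≡root = ⊥-elim (i≢root i≡root)
  ...   | no _       = ∧-zeroʳ (adj H x y)

  strongNbrSumᴿ : ℕ → (Σ (Fin m) (Fin ∘ s) → ℕ) → Σ (Fin m) (Fin ∘ s) → ℕ
  strongNbrSumᴿ k g w = ∑Σ s (λ w′ → strongContribution k (adj R w w′) (g w′))

  strongNbrSum-inside : ∀ k g x i →
    ∑[ j < s x ] strongContribution k (adj R (x , i) (x , j)) (g (x , j)) ≡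
    strongNbrSum (K x) k (restrict g x) i
  strongNbrSum-inside k g x i =
    trans (sum-cong-≗ (λ j → cong (λ a → strongContribution k a (g (x , j))) (adj-inside x i j)))
          (sym (strongNbrSum-∑ (K x) k (restrict g x) i))

  strongNbrSum-branch-≤ : ∀ k g x i → strongNbrSum (K x) k (restrict g x) i ≤ strongNbrSumᴿ k g (x , i)
  strongNbrSum-branch-≤ k g x i =
    subst (_≤ strongNbrSumᴿ k g (x , i)) (strongNbrSum-inside k g x i) (≤-∑ _ x)

  strongNbrSum-branch-nonroot : ∀ k g x i → i ≢ root x →
    strongNbrSumᴿ k g (x , i) ≡ strongNbrSum (K x) k (restrict g x) i
  strongNbrSum-branch-nonroot k g x i i≢root = trans
    (∑-single x (λ y y≢x → ∑-zero (λ j →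
      cong (λ a → strongContribution k a (g (y , j))) (adj-outside i j (y≢x ∘ sym) i≢root))))
    (strongNbrSum-inside k g x i)

  module _ {n : ℕ} (G : Graph (Fin n)) (iso : Iso G R) where

    open Inverse (proj₁ iso)
    open Transport G R iso (∑Σ s) (∑-reindexΣ s (proj₁ iso))

    vertexCount : n ≡ ∑[ x < m ] s x
    vertexCount = begin
      n                          ≡⟨ *-identityʳ n ⟨
      n * 1                      ≡⟨ ∑-const n 1 ⟨
      ∑[ v < n ] 1               ≡⟨ ∑-reindexΣ s (proj₁ iso) (λ _ → 1) ⟩
      ∑[ x < m ] ∑[ i < s x ] 1  ≡⟨ sum-cong-≗ (λ x → trans (∑-const (s x) 1) (*-identityʳ (s x))) ⟩
      ∑[ x < m ] s x             ∎
      where open ≡-Reasoning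

    IsSRDF-glue : (g : Σ (Fin m) (Fin ∘ s) → ℕ) → (∀ x → IsSRDF (K x) k (restrict g x)) →
      IsSRDF G k (g ∘ to)
    IsSRDF-glue {k} g srdf = (λ v → proj₁ (srdf (proj₁ (to v))) (proj₂ (to v))) , λ u weak →
      subst (λ t → k ≤ g (to u) + t) (sym (strongNbrSum-∘to k g u)) (defended (to u) weak)
      where
      defended : ∀ w → 2 * g w < k → k ≤ g w + strongNbrSumᴿ k g w
      defended (x , i) weak =
        ≤-trans (proj₂ (srdf x) i weak) (+-monoʳ-≤ (g (x , i)) (strongNbrSum-branch-≤ k g x i))

    IsSRDF-restrict : {f : Fin n → ℕ} → IsSRDF G k f →
      ∀ x → IsSRDFExcept (K x) k (root x) (restrict (f ∘ from) x)
    IsSRDF-restrict {k} {f} (bounded , defended) x = (λ i → bounded (from (x , i))) , λ i i≢root weak →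
      subst (λ t → k ≤ f (from (x , i)) + t) (strongNbrSum-restrict i i≢root) (defended (from (x , i)) weak)
      where
      strongNbrSum-restrict : ∀ i → i ≢ root x →
        strongNbrSum G k f (from (x , i)) ≡ strongNbrSum (K x) k (restrict (f ∘ from) x) i
      strongNbrSum-restrict i i≢root = begin
        strongNbrSum G k f (from (x , i))
          ≡⟨ strongNbrSum-cong G k (cong f ∘ sym ∘ strictlyInverseʳ) _ ⟩
        strongNbrSum G k (f ∘ from ∘ to) (from (x , i))
          ≡⟨ strongNbrSum-∘to k (f ∘ from) (from (x , i)) ⟩
        strongNbrSumᴿ k (f ∘ from) (to (from (x , i)))
          ≡⟨ cong (strongNbrSumᴿ k (f ∘ from)) (strictlyInverseˡ (x , i)) ⟩
        strongNbrSumᴿ k (f ∘ from) (x , i)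
          ≡⟨ strongNbrSum-branch-nonroot k (f ∘ from) x i i≢root ⟩
        strongNbrSum (K x) k (restrict (f ∘ from) x) i
          ∎
        where open ≡-Reasoning

    weight-∘from : (f : Fin n → ℕ) → weight f ≡ ∑Σ s (f ∘ from)
    weight-∘from f = trans (weight-cong (cong f ∘ sym ∘ strictlyInverseʳ)) (weight-∘to (f ∘ from))

    StrongRomanNumber-rootedProduct : (β : Fin m → ℕ) →
      (∀ x → BranchNumber (K x) k (root x) (β x)) → StrongRomanNumber G k (∑[ x < m ] β x)
    StrongRomanNumber-rootedProduct {k} β branchNumber =
      (g ∘ to , IsSRDF-glue g (proj₁ ∘ proj₂ ∘ optimal) , weight-g) , minimal
      where
      optimal : ∀ x → ∃ λ gₓ → IsSRDF (K x) k gₓ × weight gₓ ≡ β x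
      optimal = proj₁ ∘ branchNumber

      g : Σ (Fin m) (Fin ∘ s) → ℕ
      g (x , i) = proj₁ (optimal x) i

      weight-g : weight (g ∘ to) ≡ ∑[ x < m ] β x
      weight-g = trans (weight-∘to g)
        (sum-cong-≗ (λ x → trans (sym (weight-∑ (restrict g x))) (proj₂ (proj₂ (optimal x)))))

      minimal : ∀ f → IsSRDF G k f → ∑[ x < m ] β x ≤ weight f
      minimal f srdf = begin
        ∑[ x < m ] β x
          ≤⟨ ∑-mono-≤ (λ x → proj₂ (branchNumber x) _ (IsSRDF-restrict srdf x)) ⟩
        ∑[ x < m ] weight (restrict (f ∘ from) x)
          ≡⟨ sum-cong-≗ (λ x → weight-∑ (restrict (f ∘ from) x)) ⟩
        ∑Σ s (f ∘ from)
          ≡⟨ weight-∘from f ⟨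
        weight f
          ∎
        where open ≤-Reasoning

StrongRomanNumber-branchGraph : (Allowed : (r : ℕ) → Fin r → Set) (G : Graph (Fin n)) →
  IsBranchGraph Allowed G → (β : (r : ℕ) → Fin r → ℕ) (p q : ℕ) .{{_ : NonZero q}} →
  (∀ {r c} → Allowed r c → BranchNumber (P r) k c (β r c) × q * β r c ≡ p * r) →
  StrongRomanNumber G k (p * n / q)
StrongRomanNumber-branchGraph {n} {k} _ G (m , H , _ , s , root , allowed , iso) β p q local =
  subst (StrongRomanNumber G k) ∑b≡p*n/q
    (StrongRomanNumber-rootedProduct G iso b (λ x → proj₁ (local (allowed x))))
  where
  open RootedProductBranches H (λ x → P (s x)) root

  b : Fin m → ℕ
  b x = β (s x) (root x)

  ∑b*q≡p*n : (∑[ x < m ] b x) * q ≡ p * n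
  ∑b*q≡p*n = begin
    (∑[ x < m ] b x) * q  ≡⟨ *-comm _ q ⟩
    q * ∑[ x < m ] b x    ≡⟨ *-distribˡ-sum q b ⟩
    ∑[ x < m ] (q * b x)  ≡⟨ sum-cong-≗ (λ x → proj₂ (local (allowed x))) ⟩
    ∑[ x < m ] (p * s x)  ≡⟨ *-distribˡ-sum p s ⟨
    p * ∑[ x < m ] s x    ≡⟨ cong (p *_) (vertexCount G iso) ⟨
    p * n                 ∎
    where open ≡-Reasoning

  ∑b≡p*n/q : ∑[ x < m ] b x ≡ p * n / q
  ∑b≡p*n/q = trans (sym (m*n/n≡m _ q)) (cong (_/ q) ∑b*q≡p*n)

2*m≡m+m : ∀ m → 2 * m ≡ m + m
2*m≡m+m m = cong (m +_) (+-identityʳ m)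

≤-half-sum : ∀ {k a b} → k ≤ 2 * a → k ≤ 2 * b → k ≤ a + b
≤-half-sum {k} {a} {b} k≤2a k≤2b = *-cancelˡ-≤ 2 (begin
  2 * k          ≡⟨ 2*m≡m+m k ⟩
  k + k          ≤⟨ +-mono-≤ k≤2a k≤2b ⟩
  2 * a + 2 * b  ≡⟨ *-distribˡ-+ 2 a b ⟨
  2 * (a + b)    ∎)
  where open ≤-Reasoning

3*k≤2*w⇒k+h≤w : ∀ {k h w} → 3 * k ≤ 2 * w → 2 * h ≤ suc k → k + h ≤ w
3*k≤2*w⇒k+h≤w {k} {h} {w} 3k≤2w 2h≤1+k = ≤-pred (*-cancelˡ-< 2 (k + h) (suc w) (begin-strict
  2 * (k + h)      ≡⟨ *-distribˡ-+ 2 k h ⟩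
  2 * k + 2 * h    ≤⟨ +-monoʳ-≤ (2 * k) 2h≤1+k ⟩
  2 * k + suc k    ≡⟨ +-suc (2 * k) k ⟩
  suc (2 * k + k)  ≡⟨ cong suc (+-comm (2 * k) k) ⟩
  suc (3 * k)      ≤⟨ s≤s 3k≤2w ⟩
  suc (2 * w)      <⟨ n<1+n _ ⟩
  2 + 2 * w        ≡⟨ *-suc 2 w ⟨
  2 * suc w        ∎))
  where open ≤-Reasoning

module _ {k : ℕ} where

  private
    st : ℕ → ℕ
    st = strongContribution k true

  leaf-bound : ∀ {a b} → (2 * a < k → k ≤ a + st b) → k ≤ 2 * (a + b)
  leaf-bound {a} {b} defended with 2 * a <? k
  ... | yes weak  = ≤-trans (defended weak)
                      (≤-trans (+-monoʳ-≤ a (strongContribution-≤ k true b)) (m≤m+n (a + b) _))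
  ... | no strong = ≤-trans (≮⇒≥ strong) (*-monoʳ-≤ 2 (m≤m+n a b))

  leaf-bound-strong : ∀ {a b} → (2 * a < k → k ≤ a + st b) → k < 2 * b → k ≤ a + b
  leaf-bound-strong {a} {b} defended k<2b with 2 * a <? k
  ... | yes weak  = ≤-trans (defended weak) (+-monoʳ-≤ a (strongContribution-≤ k true b))
  ... | no strong = ≤-half-sum {k} {a} {b} (≮⇒≥ strong) (<⇒≤ k<2b)

  inner-bound : ∀ {b c d} → (2 * c < k → k ≤ c + (st b + st d)) → (2 * d < k → k ≤ d + st c) →
    2 * b ≤ k → k ≤ c + d
  inner-bound {b} {c} {d} defended-c defended-d 2b≤k with 2 * d <? k | 2 * c <? k
  ... | yes weak-d | _ = ≤-trans (defended-d weak-d)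
        (≤-trans (+-monoʳ-≤ d (strongContribution-≤ k true c)) (≤-reflexive (+-comm d c)))
  ... | no _ | yes weak-c = ≤-trans (defended-c weak-c) (+-monoʳ-≤ c (begin
        st b + st d  ≡⟨ cong (_+ st d) (strongContribution-weak {k} {b} 2b≤k) ⟩
        st d         ≤⟨ strongContribution-≤ k true d ⟩
        d            ∎))
        where open ≤-Reasoning
  ... | no strong-d | no strong-c = ≤-half-sum {k} {c} {d} (≮⇒≥ strong-c) (≮⇒≥ strong-d)

  path4-bound : ∀ {a b c d} → (2 * a < k → k ≤ a + st b) → (2 * c < k → k ≤ c + (st b + st d)) →
    (2 * d < k → k ≤ d + st c) → 3 * k ≤ 2 * (a + b) + 2 * (c + d)
  path4-bound {a} {b} {c} {d} defended-a defended-c defended-d with k <? 2 * b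
  ... | yes strong-b = subst (_≤ 2 * (a + b) + 2 * (c + d)) (+-comm (2 * k) k)
        (+-mono-≤ (*-monoʳ-≤ 2 (leaf-bound-strong {a} {b} defended-a strong-b))
                  (subst (k ≤_) (cong (2 *_) (+-comm d c)) (leaf-bound {d} {c} defended-d)))
  ... | no weak-b = +-mono-≤ (leaf-bound {a} {b} defended-a)
        (*-monoʳ-≤ 2 (inner-bound {b} {c} {d} defended-c defended-d (≮⇒≥ weak-b)))

P4-lowerBound : ∀ {k c} → (toℕ c ≡ 1) ⊎ (toℕ c ≡ 2) → (g : Fin 4 → ℕ) → IsSRDFExcept (P 4) k c g →
  3 * k ≤ 2 * weight g
P4-lowerBound {k} {1F} (inj₁ refl) g (_ , defended) =
  subst (3 * k ≤_) (pairs≡2*weight (g 0F) (g 1F) (g 2F) (g 3F))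
    (path4-bound {k} {g 0F} {g 1F} {g 2F} {g 3F}
      (at 0F (λ ()) (+-identityʳ _))
      (at 2F (λ ()) (cong (st (g 1F) +_) (+-identityʳ (st (g 3F)))))
      (at 3F (λ ()) (+-identityʳ _)))
  where
  st = strongContribution k true
  at : ∀ u {t} → u ≢ 1F → strongNbrSum (P 4) k g u ≡ t → 2 * g u < k → k ≤ g u + t
  at u u≢c eq = subst (λ t → k ≤ g u + t) eq ∘ defended u u≢c
  pairs≡2*weight : ∀ a b c d → 2 * (a + b) + 2 * (c + d) ≡ 2 * (a + (b + (c + (d + 0))))
  pairs≡2*weight = solve-∀
P4-lowerBound {k} {2F} (inj₂ refl) g (_ , defended) =
  subst (3 * k ≤_) (pairs≡2*weight (g 0F) (g 1F) (g 2F) (g 3F))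
    (path4-bound {k} {g 3F} {g 2F} {g 1F} {g 0F}
      (at 3F (λ ()) (+-identityʳ _))
      (at 1F (λ ()) (trans (cong (st (g 0F) +_) (+-identityʳ (st (g 2F)))) (+-comm (st (g 0F)) (st (g 2F)))))
      (at 0F (λ ()) (+-identityʳ _)))
  where
  st = strongContribution k true
  at : ∀ u {t} → u ≢ 2F → strongNbrSum (P 4) k g u ≡ t → 2 * g u < k → k ≤ g u + t
  at u u≢c eq = subst (λ t → k ≤ g u + t) eq ∘ defended u u≢c
  pairs≡2*weight : ∀ a b c d → 2 * (d + c) + 2 * (b + a) ≡ 2 * (a + (b + (c + (d + 0))))
  pairs≡2*weight = solve-∀

-- The hypotheses on h say that h = ⌈k/2⌉.
P4-branchNumber : ∀ {k h r c} → k ≤ 2 * h → 2 * h ≤ suc k → P4Root r c → BranchNumber (P r) k c (k + h)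
P4-branchNumber {k} {h} k≤2h 2h≤1+k (refl , rooted) =
  (optimum , (bounded , defended) , cong (k +_) (+-identityʳ h)) ,
  λ g srdf → 3*k≤2*w⇒k+h≤w (P4-lowerBound rooted g srdf) 2h≤1+k
  where
  optimum : Fin 4 → ℕ
  optimum = 0 ∷ k ∷ 0 ∷ h ∷ []

  h≤k : h ≤ k
  h≤k = ≮⇒≥ λ k<h → <⇒≱ (begin-strict
    suc k          <⟨ m<m+n (suc k) z<s ⟩
    suc k + suc k  ≤⟨ +-mono-≤ k<h k<h ⟩
    h + h          ≡⟨ 2*m≡m+m h ⟨
    2 * h          ∎) 2h≤1+k
    where open ≤-Reasoning

  bounded : ∀ v → optimum v ≤ k
  bounded 0F = z≤n
  bounded 1F = ≤-refl
  bounded 2F = z≤n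
  bounded 3F = h≤k

  k-strong : 0 < k → strongContribution k true k ≡ k
  k-strong 0<k = strongContribution-strong (subst (k <_) (sym (2*m≡m+m k)) (m<m+n k 0<k))

  defended : ∀ u → Defended (P 4) k optimum u
  defended 0F 0<k = ≤-reflexive (sym (trans (+-identityʳ _) (k-strong 0<k)))
  defended 1F 2k<k = ⊥-elim (<⇒≱ 2k<k (m≤m+n k _))
  defended 2F 0<k = ≤-trans (≤-reflexive (sym (k-strong 0<k))) (m≤m+n _ _)
  defended 3F 2h<k = ⊥-elim (<⇒≱ 2h<k k≤2h)

allUpTo : ℕ → (ℕ → Bool) → Bool
allUpTo zero    q = q zero
allUpTo (suc k) q = q (suc k) ∧ allUpTo k q

allUpTo-sound : ∀ {k} (q : ℕ → Bool) → T (allUpTo k q) → ∀ {x} → x ≤ k → T (q x)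
allUpTo-sound {zero}  q ok z≤n = ok
allUpTo-sound {suc k} q ok x≤1+k with m≤n⇒m<n∨m≡n x≤1+k
... | inj₁ x<1+k = allUpTo-sound q (proj₂ (Equivalence.to T-∧ ok)) (≤-pred x<1+k)
... | inj₂ refl  = proj₁ (Equivalence.to T-∧ ok)

allBounded : (r k : ℕ) → ((Fin r → ℕ) → Bool) → Bool
allBounded zero    k p = p []
allBounded (suc r) k p = allUpTo k (λ x → allBounded r k (λ g → p (x ∷ g)))

allBounded-sound : ∀ r {k} (p : (Fin r → ℕ) → Bool) → (∀ {g h} → g ≗ h → T (p g) → T (p h)) →
  T (allBounded r k p) → ∀ g → (∀ i → g i ≤ k) → T (p g)
allBounded-sound zero    p resp ok g bounded = resp (λ ()) ok
allBounded-sound (suc r) p resp ok g bounded =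
  resp head∷tail
    (allBounded-sound r (λ h → p (g zero ∷ h)) (resp ∘ ∷-cong) (allUpTo-sound _ ok (bounded zero))
      (g ∘ suc) (bounded ∘ suc))
  where
  head∷tail : (g zero ∷ g ∘ suc) ≗ g
  head∷tail zero    = refl
  head∷tail (suc i) = refl

  ∷-cong : ∀ {h h′} → h ≗ h′ → (g zero ∷ h) ≗ (g zero ∷ h′)
  ∷-cong h≗h′ zero    = refl
  ∷-cong h≗h′ (suc i) = h≗h′ i

-- The certificate is an equation, checked by `refl` much faster than `tt : T …` would be, and it
-- tests the weight first so that Q is only evaluated on light functions.
weight-lowerBound-byEnumeration : ∀ {r} k b {Q : (Fin r → ℕ) → Set} (Q? : ∀ g → Dec (Q g)) →
  (∀ {g h} → g ≗ h → Q g → Q h) → allBounded r k (λ g → ⌊ b ≤? weight g ⊎-dec ¬? (Q? g) ⌋) ≡ true →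
  ∀ g → (∀ i → g i ≤ k) → Q g → b ≤ weight g
weight-lowerBound-byEnumeration {r} k b Q? Q-resp ok g bounded q =
  [ id , (λ ¬q → ⊥-elim (¬q q)) ]
    (toWitness (allBounded-sound r _ resp (Equivalence.from T-≡ ok) g bounded))
  where
  resp : ∀ {g h} → g ≗ h → True (b ≤? weight g ⊎-dec ¬? (Q? g)) → True (b ≤? weight h ⊎-dec ¬? (Q? h))
  resp g≗h bound-g = fromWitness
    (Sum.map (subst (b ≤_) (weight-cong g≗h)) (_∘ Q-resp (sym ∘ g≗h)) (toWitness bound-g))

Defended? : (G : Graph (Fin n)) (k : ℕ) (f : Fin n → ℕ) (u : Fin n) → Dec (Defended G k f u)
Defended? G k f u = (2 * f u <? k) →-dec (k ≤? f u + strongNbrSum G k f u)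

IsSRDF? : (G : Graph (Fin n)) (k : ℕ) (f : Fin n → ℕ) → Dec (IsSRDF G k f)
IsSRDF? G k f = all? (λ v → f v ≤? k) ×-dec all? (Defended? G k f)

IsSRDFExcept? : (G : Graph (Fin n)) (k : ℕ) (c : Fin n) (f : Fin n → ℕ) → Dec (IsSRDFExcept G k c f)
IsSRDFExcept? G k c f = all? (λ v → f v ≤? k) ×-dec all? (λ u → ¬? (u ≟ c) →-dec Defended? G k f u)

StrongRomanNumber-byEnumeration : (G : Graph (Fin n)) (k : ℕ) (g : Fin n → ℕ) → True (IsSRDF? G k g) →
  allBounded n k (λ f → ⌊ weight g ≤? weight f ⊎-dec ¬? (IsSRDF? G k f) ⌋) ≡ true →
  StrongRomanNumber G k (weight g)
StrongRomanNumber-byEnumeration G k g srdf ok = (g , toWitness srdf , refl) , λ f srdf-f →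
  weight-lowerBound-byEnumeration k (weight g) (IsSRDF? G k) (IsSRDF-resp-≗ G) ok f (proj₁ srdf-f) srdf-f

BranchNumber-byEnumeration : (K : Graph (Fin n)) (k : ℕ) (c : Fin n) (g : Fin n → ℕ) →
  True (IsSRDF? K k g) →
  allBounded n k (λ f → ⌊ weight g ≤? weight f ⊎-dec ¬? (IsSRDFExcept? K k c f) ⌋) ≡ true →
  BranchNumber K k c (weight g)
BranchNumber-byEnumeration K k c g srdf ok = (g , toWitness srdf , refl) , λ f srdf-f →
  weight-lowerBound-byEnumeration k (weight g) (IsSRDFExcept? K k c) (IsSRDFExcept-resp-≗ K) ok
    f (proj₁ srdf-f) srdf-f

C5-γ₈ : StrongRomanNumber C5 8 15
C5-γ₈ = StrongRomanNumber-byEnumeration C5 8 (0 ∷ 5 ∷ 0 ∷ 5 ∷ 5 ∷ []) tt refl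

C5-γ : (k ≡ 2) ⊎ (k ≡ 4) ⊎ (k ≡ 6) → StrongRomanNumber C5 k (2 * k)
C5-γ (inj₁ refl)        = StrongRomanNumber-byEnumeration C5 2 (0 ∷ 0 ∷ 2 ∷ 0 ∷ 2 ∷ []) tt refl
C5-γ (inj₂ (inj₁ refl)) = StrongRomanNumber-byEnumeration C5 4 (0 ∷ 0 ∷ 4 ∷ 0 ∷ 4 ∷ []) tt refl
C5-γ (inj₂ (inj₂ refl)) = StrongRomanNumber-byEnumeration C5 6 (0 ∷ 0 ∷ 6 ∷ 0 ∷ 6 ∷ []) tt refl

P5-branchNumber₈ : ∀ {r c} → P5Root r c → BranchNumber (P r) 8 c (3 * r)
P5-branchNumber₈ {c = 2F} (refl , refl) =
  BranchNumber-byEnumeration (P 5) 8 2F (5 ∷ 0 ∷ 5 ∷ 0 ∷ 5 ∷ []) tt refl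

P5-branchNumber : ∀ {r c} → P5Root r c → (k ≡ 2) ⊎ (k ≡ 4) ⊎ (k ≡ 6) → BranchNumber (P r) k c (2 * k)
P5-branchNumber {c = 2F} (refl , refl) (inj₁ refl) =
  BranchNumber-byEnumeration (P 5) 2 2F (0 ∷ 2 ∷ 0 ∷ 2 ∷ 0 ∷ []) tt refl
P5-branchNumber {c = 2F} (refl , refl) (inj₂ (inj₁ refl)) =
  BranchNumber-byEnumeration (P 5) 4 2F (0 ∷ 4 ∷ 0 ∷ 4 ∷ 0 ∷ []) tt refl
P5-branchNumber {c = 2F} (refl , refl) (inj₂ (inj₂ refl)) =
  BranchNumber-byEnumeration (P 5) 6 2F (0 ∷ 6 ∷ 0 ∷ 6 ∷ 0 ∷ []) tt refl

P4-branchNumber₈ : ∀ {r c} → P4Root r c → BranchNumber (P r) 8 c (3 * r)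
P4-branchNumber₈ root@(refl , _) = P4-branchNumber {8} {4} ≤-refl (n≤1+n 8) root

StrongRomanNumber-threePerVertex : (Allowed : (r : ℕ) → Fin r → Set) (G : Graph (Fin n)) →
  IsBranchGraph Allowed G → (∀ {r c} → Allowed r c → BranchNumber (P r) 8 c (3 * r)) →
  StrongRomanNumber G 8 (3 * n)
StrongRomanNumber-threePerVertex {n} Allowed G branch local =
  subst (StrongRomanNumber G 8) (n/1≡n (3 * n))
    (StrongRomanNumber-branchGraph Allowed G branch (λ r _ → 3 * r) 3 1 (λ root → local root , *-identityˡ _))

P5-γ : (G : Graph (Fin n)) → IsBranchGraph P5Root G → (k ≡ 2) ⊎ (k ≡ 4) ⊎ (k ≡ 6) →
  StrongRomanNumber G k (2 * k * n / 5)
P5-γ {k = k} G branch k∈ = StrongRomanNumber-branchGraph P5Root G branch (λ _ _ → 2 * k) (2 * k) 5 local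
  where
  local : ∀ {r c} → P5Root r c → BranchNumber (P r) k c (2 * k) × 5 * (2 * k) ≡ 2 * k * r
  local root@(refl , _) = P5-branchNumber root k∈ , *-comm 5 (2 * k)

P4-γ : (G : Graph (Fin n)) → IsBranchGraph P4Root G → ∀ k h p → k ≤ 2 * h → 2 * h ≤ suc k →
  8 * (k + h) ≡ p * 4 → StrongRomanNumber G k (p * n / 8)
P4-γ G branch k h p k≤2h 2h≤1+k rate =
  StrongRomanNumber-branchGraph P4Root G branch (λ _ _ → k + h) p 8 local
  where
  local : ∀ {r c} → P4Root r c → BranchNumber (P r) k c (k + h) × 8 * (k + h) ≡ p * r
  local root@(refl , _) = P4-branchNumber k≤2h 2h≤1+k root , rate

P4-γ-even : (G : Graph (Fin n)) → IsBranchGraph P4Root G → ∀ j →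
  StrongRomanNumber G (2 * j) (3 * (2 * j) * n / 8)
P4-γ-even G branch j = P4-γ G branch (2 * j) j (3 * (2 * j)) ≤-refl (n≤1+n _) (rate j)
  where
  rate : ∀ j → 8 * (2 * j + j) ≡ 3 * (2 * j) * 4
  rate = solve-∀

P4-γ-odd : (G : Graph (Fin n)) → IsBranchGraph P4Root G → ∀ j →
  StrongRomanNumber G (suc (2 * j)) ((3 * suc (2 * j) + 1) * n / 8)
P4-γ-odd G branch j = P4-γ G branch (suc (2 * j)) (suc j) (3 * suc (2 * j) + 1)
  (subst (suc (2 * j) ≤_) (sym (*-suc 2 j)) (n≤1+n _)) (≤-reflexive (*-suc 2 j)) (rate j)
  where
  rate : ∀ j → 8 * (suc (2 * j) + suc j) ≡ (3 * suc (2 * j) + 1) * 4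
  rate = solve-∀

lemma3p3 : (n : ℕ) (G : Graph (Fin n)) → Connected G → 3 ≤ n →
    (Iso G C5 →
      StrongRomanNumber G 8 15 ×
      (∀ k → (k ≡ 2) ⊎ (k ≡ 4) ⊎ (k ≡ 6) → StrongRomanNumber G k (2 * k))) ×
    (IsBranchGraph P5Root G →
      StrongRomanNumber G 8 (3 * n) ×
      (∀ k → (k ≡ 2) ⊎ (k ≡ 4) ⊎ (k ≡ 6) → StrongRomanNumber G k ((2 * k * n) / 5))) ×
    (IsBranchGraph P4Root G →
      ∀ k → (∃ λ j → k ≡ 2 * j) → 8 ≤ k → StrongRomanNumber G k ((3 * k * n) / 8)) ×
    (IsBranchGraph P4Root G →
      ∀ k → (∃ λ j → k ≡ suc (2 * j)) → 3 ≤ k → StrongRomanNumber G k (((3 * k + 1) * n) / 8)) ×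
    (IsBranchGraph P4P5Root G → StrongRomanNumber G 8 (3 * n))
lemma3p3 n G _ _ =
  (λ iso → StrongRomanNumber-Iso G C5 iso C5-γ₈ , λ _ k∈ → StrongRomanNumber-Iso G C5 iso (C5-γ k∈)) ,
  (λ branch → StrongRomanNumber-threePerVertex P5Root G branch P5-branchNumber₈ , λ _ → P5-γ G branch) ,
  (λ { branch _ (j , refl) _ → P4-γ-even G branch j }) ,
  (λ { branch _ (j , refl) _ → P4-γ-odd G branch j }) ,
  (λ branch → StrongRomanNumber-threePerVertex P4P5Root G branch
    λ { (inj₁ root) → P4-branchNumber₈ root ; (inj₂ root) → P5-branchNumber₈ root })
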